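{- Let $q$ be an odd prime power with $q\equiv 1\pmod 3$, let $m=(q-1)/3$, and let $\gamma$ be a generator of the multiplicative group $\mathbf{F}_q^*$. For $k\in\{0,1,\dots,m-1\}$ define $a,b,c,d,e,f\in\mathbf{F}_q^*$ by $$a=\frac{2\gamma^{3k+2}}{3},\quad b=\frac{\gamma^{m}}{3},\quad c=\frac{ -\gamma^{m+3k+2}}{3},\quad d=\frac{\gamma^{2m}}{3},\quad e=\frac{ -\gamma^{2m+3k+2}}{3},\quad f=\frac{1}{3}.$$ Then the polynomial $$g(x)=ax^{3m-1}+bx^{2m+1}+cx^{2m-1}+dx^{m+1}+ex^{m-1}+fx$$ is a permutation polynomial over $\mathbf{F}_q$, and the permutation of $\mathbf{F}_q$ it induces is an involution with exactly $m+1$ fixed points.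
   Context: $\mathbf{F}_q$ denotes the finite field with $q$ elements. A permutation polynomial over $\mathbf{F}_q$ is a polynomial $g\in\mathbf{F}_q[x]$ whose associated map $\mathbf{F}_q\to\mathbf{F}_q$, $x\mapsto g(x)$, is a bijection; it is involutory if $g(g(x))=x$ for all $x\in\mathbf{F}_q$. -}

module Defs where

open import Level using (0ℓ)
open import Data.Nat as ℕ using (ℕ; zero; suc)
open import Data.Fin using (Fin)
open import Data.Product using (∃; Σ)
open import Relation.Binary.PropositionalEquality using (_≡_; _≢_)
open import Algebra.Structures using (IsCommutativeRing)
open import Function.Bundles using (_↔_)

record FiniteField (q : ℕ) : Set₁ where
  infixl 6 _+_
  infixl 7 _*_
  field
    Carrier : Set
    _+_ _*_ : Carrier → Carrier → Carrier
    -_      : Carrier → Carrier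
    0# 1#   : Carrier
    isCommutativeRing : IsCommutativeRing _≡_ _+_ _*_ -_ 0# 1#
    0≢1     : 0# ≢ 1#
    inverse : ∀ x → x ≢ 0# → ∃ λ y → x * y ≡ 1#
    enum    : Carrier ↔ Fin q

  _^_ : Carrier → ℕ → Carrier
  x ^ zero  = 1#
  x ^ suc n = x * (x ^ n)

  two three : Carrier
  two   = 1# + 1#
  three = 1# + 1# + 1#

  IsGenerator : Carrier → Set
  IsGenerator γ = (γ ≢ 0#) Data.Product.× (∀ x → x ≢ 0# → ∃ λ i → γ ^ i ≡ x)

  Involutory : (Carrier → Carrier) → Set
  Involutory g = ∀ x → g (g x) ≡ x

  HasFixedPoints : (Carrier → Carrier) → ℕ → Set
  HasFixedPoints g n = Σ Carrier (λ x → g x ≡ x) ↔ Fin n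

open import Data.Nat.Primality using (Prime)
IsPrimePower : ℕ → Set
IsPrimePower q = ∃ λ p → ∃ λ r → Prime p Data.Product.× (1 ℕ.≤ r) Data.Product.× (q ≡ p ℕ.^ r)

{-# OPTIONS --safe #-}
-- Let ω = γ ^ m, a primitive cube root of unity, and u = γ ^ (3k + 2). For x ≠ 0 the power x ^ m is
-- 1, ω or ω², and writing g in terms of y = x ^ m and w = x ^ (m - 1) (so that x w = y) shows, using
-- 1 + ω + ω² = 0 and 3t = 1, that g x = x when x ^ m = ω and g x = u / x otherwise. As u ^ m = ω², the
-- map x ↦ u / x exchanges the classes x ^ m = 1 and x ^ m = ω², so g ∘ g = id. A fixed point in these
-- classes would satisfy x² = u, hence (x ^ m)² = ω², which is impossible; so the fixed points are 0 and
-- the m elements γ ^ (3s + 1).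
module Submission where

open import Defs
open import Data.Nat as ℕ using (ℕ; _<_; _∸_; _%_; _/_; zero; suc; _≤_; z≤n; s≤s; NonZero)
open import Data.Product using (_×_; _,_; proj₁; proj₂; ∃; Σ)
open import Relation.Binary.PropositionalEquality
  using (_≡_; _≢_; refl; sym; trans; cong; cong₂; subst; module ≡-Reasoning)
open import Function.Definitions using (Bijective)

open import Level using (0ℓ)
import Data.Nat.Properties as ℕP
open import Data.Nat.DivMod using (m≡m%n+[m/n]*n; m%n<n; [m+kn]%n≡m%n; m*n/n≡m)
open import Data.Nat.Tactic.RingSolver using (solve-∀)
open import Data.Fin as Fin using (Fin; toℕ; fromℕ<; punchIn; punchOut)
import Data.Fin.Properties as FinP
open import Data.Sum using (_⊎_; inj₁; inj₂)
open import Relation.Nullary using (yes; no; contradiction)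
open import Relation.Binary.Definitions using (DecidableEquality; tri<; tri≈; tri>)
open import Function.Bundles using (_↔_; Inverse; Injection; mk↔ₛ′)
open import Function.Properties.Inverse using (↔⇒↣)
open import Function.Consequences.Propositional
  using (inverseᵇ⇒bijective; strictlyInverseˡ⇒inverseˡ; strictlyInverseʳ⇒inverseʳ)
open import Algebra.Bundles using (CommutativeRing)
import Algebra.Properties.CommutativeSemiring.Exp as Exp
import Algebra.Properties.Group as GroupProperties
import Algebra.Solver.Ring.NaturalCoefficients.Default as NaturalSolver
open import Axiom.UniquenessOfIdentityProofs using (module Decidable⇒UIP)

involutive⇒bijective : ∀ {a} {A : Set a} (f : A → A) → (∀ x → f (f x) ≡ x) → Bijective _≡_ _≡_ f
involutive⇒bijective f f∘f≡id =
  inverseᵇ⇒bijective (strictlyInverseˡ⇒inverseˡ f f∘f≡id , strictlyInverseʳ⇒inverseʳ f f∘f≡id)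

enumeration⇒Σ↔Fin : ∀ {a p n} {A : Set a} {P : A → Set p} (f : Fin n → A) →
                    (∀ i → P (f i)) → (∀ {i j} → f i ≡ f j → i ≡ j) →
                    (∀ x → P x → ∃ λ i → f i ≡ x) → (∀ {x} (px px′ : P x) → px ≡ px′) →
                    Σ A P ↔ Fin n
enumeration⇒Σ↔Fin {n = n} {A} {P} f f∈P f-injective f-onto P-irrelevant = mk↔ₛ′ to from to∘from from∘to
  where
  to : Σ A P → Fin n
  to (x , px) = proj₁ (f-onto x px)

  from : Fin n → Σ A P
  from i = f i , f∈P i

  to∘from : ∀ i → to (from i) ≡ i
  to∘from i = f-injective (proj₂ (f-onto (f i) (f∈P i)))

  from∘to : ∀ xp → from (to xp) ≡ xp
  from∘to (x , px) with f-onto x px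
  ... | i , refl = cong (f i ,_) (P-irrelevant (f∈P i) px)

3*m∸1≡m+[m+[m∸1]] : ∀ m → .{{NonZero m}} → 3 ℕ.* m ∸ 1 ≡ m ℕ.+ (m ℕ.+ (m ∸ 1))
3*m∸1≡m+[m+[m∸1]] (suc p) = identity p
  where
  identity : ∀ p → p ℕ.+ 2 ℕ.* suc p ≡ suc p ℕ.+ (suc p ℕ.+ p)
  identity = solve-∀

2*m∸1≡m+[m∸1] : ∀ m → .{{NonZero m}} → 2 ℕ.* m ∸ 1 ≡ m ℕ.+ (m ∸ 1)
2*m∸1≡m+[m∸1] (suc p) = identity p
  where
  identity : ∀ p → p ℕ.+ 1 ℕ.* suc p ≡ suc p ℕ.+ p
  identity = solve-∀

2*m≡m+m : ∀ m → 2 ℕ.* m ≡ m ℕ.+ m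
2*m≡m+m = solve-∀

2*m+e≡m+[m+e] : ∀ m e → 2 ℕ.* m ℕ.+ e ≡ m ℕ.+ (m ℕ.+ e)
2*m+e≡m+[m+e] = solve-∀

[3k+2]*m≡2*m+k*[3*m] : ∀ k m → (3 ℕ.* k ℕ.+ 2) ℕ.* m ≡ 2 ℕ.* m ℕ.+ k ℕ.* (3 ℕ.* m)
[3k+2]*m≡2*m+k*[3*m] = solve-∀

s<m⇒1+s*3<3*m : ∀ {s m} → s < m → suc (s ℕ.* 3) < 3 ℕ.* m
s<m⇒1+s*3<3*m {s} {m} s<m =
  subst (suc (s ℕ.* 3) <_) (ℕP.*-comm m 3) (ℕP.≤-trans (ℕP.n≤1+n _) (ℕP.*-monoˡ-≤ 3 s<m))

1+s*3<3*m⇒s<m : ∀ {s m} → suc (s ℕ.* 3) < 3 ℕ.* m → s < m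
1+s*3<3*m⇒s<m {s} {m} 1+s*3<3*m =
  ℕP.*-cancelʳ-< 3 s m (ℕP.<-trans (ℕP.n<1+n (s ℕ.* 3)) (subst (suc (s ℕ.* 3) <_) (ℕP.*-comm 3 m) 1+s*3<3*m))

n%3≡1⇒n≡1+3*[[n∸1]/3] : ∀ n → n % 3 ≡ 1 → n ≡ suc (3 ℕ.* ((n ∸ 1) / 3))
n%3≡1⇒n≡1+3*[[n∸1]/3] n n%3≡1 = trans n≡1+[n/3]*3 (cong suc (trans (ℕP.*-comm (n / 3) 3) (cong (3 ℕ.*_) (sym [n∸1]/3≡n/3))))
  where
  n≡1+[n/3]*3 : n ≡ suc (n / 3 ℕ.* 3)
  n≡1+[n/3]*3 = trans (m≡m%n+[m/n]*n n 3) (cong (ℕ._+ n / 3 ℕ.* 3) n%3≡1)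

  [n∸1]/3≡n/3 : (n ∸ 1) / 3 ≡ n / 3
  [n∸1]/3≡n/3 = trans (cong (λ j → (j ∸ 1) / 3) n≡1+[n/3]*3) (m*n/n≡m (n / 3) 3)

1+3*m-odd⇒2≤m : ∀ {m} → 1 ≤ m → suc (3 ℕ.* m) % 2 ≡ 1 → 2 ≤ m
1+3*m-odd⇒2≤m {suc zero}    _ ()
1+3*m-odd⇒2≤m {suc (suc _)} _ _ = s≤s (s≤s z≤n)

module FieldProperties {q : ℕ} (F : FiniteField q) where
  open FiniteField F public

  ring : CommutativeRing 0ℓ 0ℓ
  ring = record { isCommutativeRing = isCommutativeRing }

  open CommutativeRing ring public
    using (+-identityʳ; *-assoc; *-comm; *-identityˡ; *-identityʳ; zeroˡ; zeroʳ; commutativeSemiring)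

  _≟_ : DecidableEquality Carrier
  _≟_ = FinP.inj⇒≟ (↔⇒↣ enum)

  open GroupProperties (CommutativeRing.+-group ring) public using (inverseˡ-unique)

  module Solver = NaturalSolver commutativeSemiring

  *-cancelˡ : ∀ {x y z} → x ≢ 0# → x * y ≡ x * z → y ≡ z
  *-cancelˡ {x} {y} {z} x≢0 xy≡xz with x′ , xx′≡1 ← inverse x x≢0 =
    trans (sym (undo y)) (trans (cong (x′ *_) xy≡xz) (undo z))
    where
    undo : ∀ v → x′ * (x * v) ≡ v
    undo v = trans (sym (*-assoc x′ x v))
               (trans (cong (_* v) (trans (*-comm x′ x) xx′≡1)) (*-identityˡ v))

  x*y≢0 : ∀ {x y} → x ≢ 0# → y ≢ 0# → x * y ≢ 0#
  x*y≢0 {x} x≢0 y≢0 xy≡0 = y≢0 (*-cancelˡ x≢0 (trans xy≡0 (sym (zeroʳ x))))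

  x^n≢0 : ∀ {x} n → x ≢ 0# → x ^ n ≢ 0#
  x^n≢0 zero    _   1≡0 = 0≢1 (sym 1≡0)
  x^n≢0 (suc n) x≢0 = x*y≢0 x≢0 (x^n≢0 n x≢0)

  0^n≡0 : ∀ n → .{{NonZero n}} → 0# ^ n ≡ 0#
  0^n≡0 (suc n) = zeroˡ (0# ^ n)

  -- FiniteField._^_ has the same recursion as the library's exponentiation, whose laws we import.
  private
    module E = Exp commutativeSemiring

    ^≡E^ : ∀ x n → x ^ n ≡ x E.^ n
    ^≡E^ x zero    = refl
    ^≡E^ x (suc n) = cong (x *_) (^≡E^ x n)

  ^-homo-* : ∀ x m n → x ^ (m ℕ.+ n) ≡ x ^ m * x ^ n
  ^-homo-* x m n rewrite ^≡E^ x (m ℕ.+ n) | ^≡E^ x m | ^≡E^ x n = E.^-homo-* x m n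

  ^-assocʳ : ∀ x m n → (x ^ m) ^ n ≡ x ^ (m ℕ.* n)
  ^-assocʳ x m n rewrite ^≡E^ (x ^ m) n | ^≡E^ x m | ^≡E^ x (m ℕ.* n) = E.^-assocʳ x m n

  ^-distrib-* : ∀ x y n → (x * y) ^ n ≡ x ^ n * y ^ n
  ^-distrib-* x y n rewrite ^≡E^ (x * y) n | ^≡E^ x n | ^≡E^ y n = E.^-distrib-* x y n

  1^n≡1 : ∀ n → 1# ^ n ≡ 1#
  1^n≡1 zero    = refl
  1^n≡1 (suc n) = trans (*-identityˡ (1# ^ n)) (1^n≡1 n)

  ^-periodic : ∀ {x n} → x ^ n ≡ 1# → ∀ r s → x ^ (r ℕ.+ s ℕ.* n) ≡ x ^ r
  ^-periodic {x} {n} xⁿ≡1 r s = begin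
    x ^ (r ℕ.+ s ℕ.* n)    ≡⟨ ^-homo-* x r (s ℕ.* n) ⟩
    x ^ r * x ^ (s ℕ.* n)  ≡⟨ cong (λ e → x ^ r * x ^ e) (ℕP.*-comm s n) ⟩
    x ^ r * x ^ (n ℕ.* s)  ≡⟨ cong (x ^ r *_) (sym (^-assocʳ x n s)) ⟩
    x ^ r * (x ^ n) ^ s    ≡⟨ cong (λ y → x ^ r * y ^ s) xⁿ≡1 ⟩
    x ^ r * 1# ^ s         ≡⟨ cong (x ^ r *_) (1^n≡1 s) ⟩
    x ^ r * 1#             ≡⟨ *-identityʳ (x ^ r) ⟩
    x ^ r                  ∎
    where
    open ≡-Reasoning

  ^-mod : ∀ {x n} .{{_ : NonZero n}} → x ^ n ≡ 1# → ∀ a → x ^ a ≡ x ^ (a % n)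
  ^-mod {x} {n} xⁿ≡1 a =
    trans (cong (x ^_) (m≡m%n+[m/n]*n a n)) (^-periodic xⁿ≡1 (a % n) (a / n))

  ^-≡⇒^-∸≡1 : ∀ {x} a b → x ≢ 0# → a ≤ b → x ^ a ≡ x ^ b → x ^ (b ∸ a) ≡ 1#
  ^-≡⇒^-∸≡1 {x} a b x≢0 a≤b xᵃ≡xᵇ = sym (*-cancelˡ (x^n≢0 a x≢0) (begin
    x ^ a * 1#            ≡⟨ *-identityʳ (x ^ a) ⟩
    x ^ a                 ≡⟨ xᵃ≡xᵇ ⟩
    x ^ b                 ≡⟨ cong (x ^_) (sym (ℕP.m+[n∸m]≡n a≤b)) ⟩
    x ^ (a ℕ.+ (b ∸ a))   ≡⟨ ^-homo-* x a (b ∸ a) ⟩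
    x ^ a * x ^ (b ∸ a)   ∎))
    where
    open ≡-Reasoning

module CyclicGroup {q : ℕ} (F : FiniteField q) {N : ℕ} (q≡1+N : q ≡ suc N) {{_ : NonZero N}}
                   {γ : FiniteField.Carrier F} (generator : FiniteField.IsGenerator F γ) where
  open FieldProperties F

  γ≢0 : γ ≢ 0#
  γ≢0 = proj₁ generator

  private
    index : Carrier ↔ Fin (suc N)
    index = subst (λ n → Carrier ↔ Fin n) q≡1+N enum

    open Inverse index using (to; from; strictlyInverseˡ; strictlyInverseʳ)

    to-injective : ∀ {x y} → to x ≡ to y → x ≡ y
    to-injective = Injection.injective (↔⇒↣ index)

    nonzero : Fin N → Carrier
    nonzero i = from (punchIn (to 0#) i)

    nonzero≢0 : ∀ i → nonzero i ≢ 0#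
    nonzero≢0 i e = FinP.punchInᵢ≢i (to 0#) i (trans (sym (strictlyInverseˡ _)) (cong to e))

    nonzero-injective : ∀ {i j} → nonzero i ≡ nonzero j → i ≡ j
    nonzero-injective {i} {j} e = FinP.punchIn-injective (to 0#) i j
      (trans (sym (strictlyInverseˡ _)) (trans (cong to e) (strictlyInverseˡ _)))

    nonzeroIndex : ∀ x → x ≢ 0# → Fin N
    nonzeroIndex x x≢0 = punchOut {i = to 0#} {j = to x} (λ e → x≢0 (to-injective (sym e)))

    nonzeroIndex-injective : ∀ {x y} (x≢0 : x ≢ 0#) (y≢0 : y ≢ 0#) →
                             nonzeroIndex x x≢0 ≡ nonzeroIndex y y≢0 → x ≡ y
    nonzeroIndex-injective {x} {y} _ _ e =
      to-injective (FinP.punchOut-injective {i = to 0#} {j = to x} {k = to y} _ _ e)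

  -- The N nonzero elements are powers of γ, so they inject into the residues mod the order of γ.
  N≤order : ∀ {n} → 0 < n → γ ^ n ≡ 1# → N ≤ n
  N≤order {n} 0<n γⁿ≡1 = FinP.injective⇒≤ residue-injective
    where
    instance _ = ℕ.>-nonZero 0<n

    exponent : Fin N → ℕ
    exponent i = proj₁ (proj₂ generator (nonzero i) (nonzero≢0 i))

    γ^residue : ∀ i → γ ^ (exponent i % n) ≡ nonzero i
    γ^residue i = trans (sym (^-mod γⁿ≡1 (exponent i))) (proj₂ (proj₂ generator (nonzero i) (nonzero≢0 i)))

    residue : Fin N → Fin n
    residue i = fromℕ< (m%n<n (exponent i) n)

    residue-injective : ∀ {i j} → residue i ≡ residue j → i ≡ j
    residue-injective {i} {j} e = nonzero-injective (begin
      nonzero i              ≡⟨ sym (γ^residue i) ⟩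
      γ ^ (exponent i % n)   ≡⟨ cong (γ ^_) (FinP.fromℕ<-injective _ _ _ _ e) ⟩
      γ ^ (exponent j % n)   ≡⟨ γ^residue j ⟩
      nonzero j              ∎)
      where
      open ≡-Reasoning

  -- Among γ⁰, …, γᴺ two powers coincide (pigeonhole), which gives an order at most N.
  γ^N≡1 : γ ^ N ≡ 1#
  γ^N≡1 with i , j , i<j , same ← FinP.pigeonhole (ℕP.n<1+n N) (λ i → nonzeroIndex (γ ^ toℕ i) (x^n≢0 (toℕ i) γ≢0)) =
    subst (λ e → γ ^ e ≡ 1#) (ℕP.≤-antisym n≤N (N≤order (ℕP.m<n⇒0<n∸m i<j) γⁿ≡1)) γⁿ≡1
    where
    n = toℕ j ∸ toℕ i

    γⁿ≡1 : γ ^ n ≡ 1#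
    γⁿ≡1 = ^-≡⇒^-∸≡1 (toℕ i) (toℕ j) γ≢0 (ℕP.<⇒≤ i<j)
             (nonzeroIndex-injective (x^n≢0 (toℕ i) γ≢0) (x^n≢0 (toℕ j) γ≢0) same)

    n≤N : n ≤ N
    n≤N = ℕP.≤-trans (ℕP.m∸n≤m (toℕ j) (toℕ i)) (ℕP.≤-pred (FinP.toℕ<n j))

  private
    γ^-distinct : ∀ {a b} → a < b → b < N → γ ^ a ≢ γ ^ b
    γ^-distinct {a} {b} a<b b<N γᵃ≡γᵇ = ℕP.<⇒≱ (ℕP.≤-<-trans (ℕP.m∸n≤m b a) b<N)
      (N≤order (ℕP.m<n⇒0<n∸m a<b) (^-≡⇒^-∸≡1 a b γ≢0 (ℕP.<⇒≤ a<b) γᵃ≡γᵇ))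

  γ^-injective : ∀ {a b} → a < N → b < N → γ ^ a ≡ γ ^ b → a ≡ b
  γ^-injective {a} {b} a<N b<N γᵃ≡γᵇ with ℕP.<-cmp a b
  ... | tri< a<b _ _ = contradiction γᵃ≡γᵇ (γ^-distinct a<b b<N)
  ... | tri≈ _ a≡b _ = a≡b
  ... | tri> _ _ b<a = contradiction (sym γᵃ≡γᵇ) (γ^-distinct b<a a<N)

  log : ∀ x → x ≢ 0# → ∃ λ i → i < N × γ ^ i ≡ x
  log x x≢0 with i , γⁱ≡x ← proj₂ generator x x≢0 =
    i % N , m%n<n i N , trans (sym (^-mod γ^N≡1 i)) γⁱ≡x

  x^N≡1 : ∀ {x} → x ≢ 0# → x ^ N ≡ 1#
  x^N≡1 {x} x≢0 with i , _ , refl ← log x x≢0 = trans (^-assocʳ γ i N) (^-periodic γ^N≡1 0 i)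

  infix 30 _⁻¹
  _⁻¹ : Carrier → Carrier
  x ⁻¹ = x ^ (N ∸ 1)

  x*x⁻¹≡1 : ∀ {x} → x ≢ 0# → x * x ⁻¹ ≡ 1#
  x*x⁻¹≡1 {x} x≢0 = trans (cong (x ^_) (ℕP.m+[n∸m]≡n (ℕ.>-nonZero⁻¹ N))) (x^N≡1 x≢0)

  x⁻¹≢0 : ∀ {x} → x ≢ 0# → x ⁻¹ ≢ 0#
  x⁻¹≢0 = x^n≢0 (N ∸ 1)

  x*y≡z⇒z*x⁻¹≡y : ∀ {x y z} → x ≢ 0# → x * y ≡ z → z * x ⁻¹ ≡ y
  x*y≡z⇒z*x⁻¹≡y {x} {y} x≢0 refl = begin
    x * y * x ⁻¹     ≡⟨ solve 3 (λ x y x⁻¹ → x :* y :* x⁻¹ := y :* (x :* x⁻¹)) refl x y (x ⁻¹) ⟩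
    y * (x * x ⁻¹)   ≡⟨ cong (y *_) (x*x⁻¹≡1 x≢0) ⟩
    y * 1#           ≡⟨ *-identityʳ y ⟩
    y                ∎
    where
    open ≡-Reasoning
    open Solver

module CubeRoots {q : ℕ} (F : FiniteField q) {m : ℕ} (q≡1+3m : q ≡ suc (3 ℕ.* m)) {{_ : NonZero m}}
                 {γ : FiniteField.Carrier F} (generator : FiniteField.IsGenerator F γ) where
  open FieldProperties F
  open CyclicGroup F q≡1+3m {{ℕP.m*n≢0 3 m}} generator public

  ω : Carrier
  ω = γ ^ m

  ω^3≡1 : ω ^ 3 ≡ 1#
  ω^3≡1 = trans (^-assocʳ γ m 3) (trans (cong (γ ^_) (ℕP.*-comm m 3)) γ^N≡1)

  ω^-injective : ∀ {r s} → r < 3 → s < 3 → ω ^ r ≡ ω ^ s → r ≡ s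
  ω^-injective {r} {s} r<3 s<3 ωʳ≡ωˢ = ℕP.*-cancelˡ-≡ r s m
    (γ^-injective (m*<3m r<3) (m*<3m s<3)
      (trans (sym (^-assocʳ γ m r)) (trans ωʳ≡ωˢ (^-assocʳ γ m s))))
    where
    m*<3m : ∀ {i} → i < 3 → m ℕ.* i < 3 ℕ.* m
    m*<3m {i} i<3 = subst (m ℕ.* i <_) (ℕP.*-comm m 3) (ℕP.*-monoʳ-< m i<3)

  ω≢0 : ω ≢ 0#
  ω≢0 = x^n≢0 m γ≢0

  ω≢1 : ω ≢ 1#
  ω≢1 ω≡1 with () ← ω^-injective {1} {0} (s≤s (s≤s z≤n)) (s≤s z≤n) (trans (*-identityʳ ω) ω≡1)

  ω*ω≢1 : ω * ω ≢ 1#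
  ω*ω≢1 ω²≡1 with () ← ω^-injective {2} {0} ℕP.≤-refl (s≤s z≤n) (trans (cong (ω *_) (*-identityʳ ω)) ω²≡1)

  Φ₃ : Carrier
  Φ₃ = 1# + ω + ω * ω

  -- ω is a root of Φ₃ because Φ₃ * (ω - 1) = ω³ - 1 = 0 and ω ≠ 1.
  Φ₃≡0 : Φ₃ ≡ 0#
  Φ₃≡0 with Φ₃ ≟ 0#
  ... | yes Φ₃≡0 = Φ₃≡0
  ... | no  Φ₃≢0 = contradiction (*-cancelˡ Φ₃≢0 (begin
    Φ₃ * ω                  ≡⟨ solve 1 (λ w → (con 1 :+ w :+ w :* w) :* w := w :* (w :* (w :* con 1)) :+ w :+ w :* w) refl ω ⟩
    ω ^ 3 + ω + ω * ω       ≡⟨ cong (λ c → c + ω + ω * ω) ω^3≡1 ⟩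
    Φ₃                      ≡⟨ sym (*-identityʳ Φ₃) ⟩
    Φ₃ * 1#                 ∎)) ω≢1
    where
    open ≡-Reasoning
    open Solver

  ≡-mod-Φ₃ : ∀ {l r} p p′ → l + p * Φ₃ ≡ r + p′ * Φ₃ → l ≡ r
  ≡-mod-Φ₃ {l} {r} p p′ e = begin
    l               ≡⟨ sym (+-identityʳ l) ⟩
    l + 0#          ≡⟨ cong (l +_) (sym (trans (cong (p *_) Φ₃≡0) (zeroʳ p))) ⟩
    l + p * Φ₃      ≡⟨ e ⟩
    r + p′ * Φ₃     ≡⟨ cong (r +_) (trans (cong (p′ *_) Φ₃≡0) (zeroʳ p′)) ⟩
    r + 0#          ≡⟨ +-identityʳ r ⟩
    r               ∎
    where
    open ≡-Reasoning

  -- The solver below works over semirings; these rewrite the negative coefficients of g.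
  -[ω*x]≡[1+ω*ω]*x : ∀ x → - (ω * x) ≡ (1# + ω * ω) * x
  -[ω*x]≡[1+ω*ω]*x x = sym (inverseˡ-unique _ _ (begin
    (1# + ω * ω) * x + ω * x   ≡⟨ solve 2 (λ w x → (con 1 :+ w :* w) :* x :+ w :* x := (con 1 :+ w :+ w :* w) :* x) refl ω x ⟩
    Φ₃ * x                     ≡⟨ cong (_* x) Φ₃≡0 ⟩
    0# * x                     ≡⟨ zeroˡ x ⟩
    0#                         ∎))
    where
    open ≡-Reasoning
    open Solver

  -[ω*[ω*x]]≡[1+ω]*x : ∀ x → - (ω * (ω * x)) ≡ (1# + ω) * x
  -[ω*[ω*x]]≡[1+ω]*x x = sym (inverseˡ-unique _ _ (begin
    (1# + ω) * x + ω * (ω * x)   ≡⟨ solve 2 (λ w x → (con 1 :+ w) :* x :+ w :* (w :* x) := (con 1 :+ w :+ w :* w) :* x) refl ω x ⟩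
    Φ₃ * x                       ≡⟨ cong (_* x) Φ₃≡0 ⟩
    0# * x                       ≡⟨ zeroˡ x ⟩
    0#                           ∎))
    where
    open ≡-Reasoning
    open Solver

  ^m-of-γ^ : ∀ i → (γ ^ i) ^ m ≡ ω ^ (i % 3)
  ^m-of-γ^ i = begin
    (γ ^ i) ^ m     ≡⟨ ^-assocʳ γ i m ⟩
    γ ^ (i ℕ.* m)   ≡⟨ cong (γ ^_) (ℕP.*-comm i m) ⟩
    γ ^ (m ℕ.* i)   ≡⟨ sym (^-assocʳ γ m i) ⟩
    ω ^ i           ≡⟨ ^-mod ω^3≡1 i ⟩
    ω ^ (i % 3)     ∎
    where
    open ≡-Reasoning

  classify : ∀ {x} → x ≢ 0# → x ^ m ≡ ω ⊎ (x ^ m ≡ 1# ⊎ x ^ m ≡ ω * ω)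
  classify {x} x≢0 with i , _ , refl ← log x x≢0 = byResidue (i % 3) (m%n<n i 3) (^m-of-γ^ i)
    where
    byResidue : ∀ r → r < 3 → x ^ m ≡ ω ^ r → x ^ m ≡ ω ⊎ (x ^ m ≡ 1# ⊎ x ^ m ≡ ω * ω)
    byResidue 0 _ e = inj₂ (inj₁ e)
    byResidue 1 _ e = inj₁ (trans e (*-identityʳ ω))
    byResidue 2 _ e = inj₂ (inj₂ (trans e (cong (ω *_) (*-identityʳ ω))))
    byResidue (suc (suc (suc _))) (s≤s (s≤s (s≤s ())))

module Involution {q : ℕ} (F : FiniteField q) {m : ℕ} (q≡1+3m : q ≡ suc (3 ℕ.* m)) (2≤m : 2 ≤ m)
                  {γ : FiniteField.Carrier F} (generator : FiniteField.IsGenerator F γ) (k : ℕ)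
                  {t : FiniteField.Carrier F} (3t≡1 : FiniteField._*_ F (FiniteField.three F) t ≡ FiniteField.1# F) where
  open FieldProperties F

  private instance
    m≢0 : NonZero m
    m≢0 = ℕ.>-nonZero (ℕP.<-trans (s≤s z≤n) 2≤m)

    m∸1≢0 : NonZero (m ∸ 1)
    m∸1≢0 = ℕ.>-nonZero (ℕP.m<n⇒0<n∸m 2≤m)

  open CubeRoots F q≡1+3m generator

  u : Carrier
  u = γ ^ (3 ℕ.* k ℕ.+ 2)

  x^[3m∸1] : ∀ x → x ^ (3 ℕ.* m ∸ 1) ≡ x ^ m * (x ^ m * x ^ (m ∸ 1))
  x^[3m∸1] x = trans (cong (x ^_) (3*m∸1≡m+[m+[m∸1]] m))
                 (trans (^-homo-* x m _) (cong (x ^ m *_) (^-homo-* x m _)))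

  γ^[2m] : γ ^ (2 ℕ.* m) ≡ ω * ω
  γ^[2m] = trans (cong (γ ^_) (2*m≡m+m m)) (^-homo-* γ m m)

  g : Carrier → Carrier
  g x = two * γ ^ (3 ℕ.* k ℕ.+ 2) * t * x ^ (3 ℕ.* m ∸ 1) + γ ^ m * t * x ^ (2 ℕ.* m ℕ.+ 1)
        + - (γ ^ (m ℕ.+ 3 ℕ.* k ℕ.+ 2)) * t * x ^ (2 ℕ.* m ∸ 1) + γ ^ (2 ℕ.* m) * t * x ^ (m ℕ.+ 1)
        + - (γ ^ (2 ℕ.* m ℕ.+ 3 ℕ.* k ℕ.+ 2)) * t * x ^ (m ∸ 1) + t * x

  -- Every exponent of g is i·m or i·m ± 1, so g x = ĝ (x ^ m) (x ^ (m ∸ 1)) x; ĝ also has no minus signs.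
  ĝ : Carrier → Carrier → Carrier → Carrier
  ĝ y w x = two * u * t * (y * (y * w)) + ω * t * (y * (y * x)) + (1# + ω * ω) * u * t * (y * w)
            + ω * ω * t * (y * x) + (1# + ω) * u * t * w + t * x

  g≡ĝ : ∀ x → g x ≡ ĝ (x ^ m) (x ^ (m ∸ 1)) x
  g≡ĝ x = cong₂ _+_ (cong₂ _+_ (cong₂ _+_ (cong₂ _+_ (cong₂ _+_
      (cong (two * u * t *_) (x^[3m∸1] x))
      (cong (ω * t *_) x^[2m+1]))
      (cong₂ _*_ (cong (_* t) (trans (cong -_ γ^[m+3k+2]) (-[ω*x]≡[1+ω*ω]*x u))) x^[2m∸1]))
      (cong₂ _*_ (cong (_* t) γ^[2m]) x^[m+1]))
      (cong (λ c → c * t * w) (trans (cong -_ γ^[2m+3k+2]) (-[ω*[ω*x]]≡[1+ω]*x u))))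
      refl
    where
    y w : Carrier
    y = x ^ m
    w = x ^ (m ∸ 1)

    x^[m+1] : x ^ (m ℕ.+ 1) ≡ y * x
    x^[m+1] = trans (^-homo-* x m 1) (cong (y *_) (*-identityʳ x))

    x^[2m+1] : x ^ (2 ℕ.* m ℕ.+ 1) ≡ y * (y * x)
    x^[2m+1] = trans (cong (x ^_) (2*m+e≡m+[m+e] m 1)) (trans (^-homo-* x m _) (cong (y *_) x^[m+1]))

    x^[2m∸1] : x ^ (2 ℕ.* m ∸ 1) ≡ y * w
    x^[2m∸1] = trans (cong (x ^_) (2*m∸1≡m+[m∸1] m)) (^-homo-* x m _)

    γ^[m+3k+2] : γ ^ (m ℕ.+ 3 ℕ.* k ℕ.+ 2) ≡ ω * u
    γ^[m+3k+2] = trans (cong (γ ^_) (ℕP.+-assoc m (3 ℕ.* k) 2)) (^-homo-* γ m _)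

    γ^[2m+3k+2] : γ ^ (2 ℕ.* m ℕ.+ 3 ℕ.* k ℕ.+ 2) ≡ ω * (ω * u)
    γ^[2m+3k+2] = trans (cong (γ ^_) (trans (ℕP.+-assoc (2 ℕ.* m) (3 ℕ.* k) 2) (2*m+e≡m+[m+e] m _)))
                    (trans (^-homo-* γ m _) (cong (ω *_) (^-homo-* γ m _)))

  private
    3t*v≡v : ∀ v → three * t * v ≡ v
    3t*v≡v v = trans (cong (_* v) 3t≡1) (*-identityˡ v)

    open Solver using (Polynomial; con; _:+_; _:*_)

    ĝ-polynomial : ∀ {n} (u t ω y w x : Polynomial n) → Polynomial n
    ĝ-polynomial u t ω y w x =
      con 2 :* u :* t :* (y :* (y :* w)) :+ ω :* t :* (y :* (y :* x)) :+ (con 1 :+ ω :* ω) :* u :* t :* (y :* w)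
      :+ ω :* ω :* t :* (y :* x) :+ (con 1 :+ ω) :* u :* t :* w :+ t :* x

    Φ₃-polynomial : ∀ {n} → Polynomial n → Polynomial n
    Φ₃-polynomial ω = con 1 :+ ω :+ ω :* ω

  -- In each case the difference of the two sides is a multiple of Φ₃; the cofactors are explicit.
  ĝ-ω : ∀ w x → ĝ ω w x ≡ x
  ĝ-ω w x = trans (≡-mod-Φ₃ (two * t * x) (two * t * x * ω + u * t * w * (ω + 1#))
      (solve 5 (λ u t ω w x →
         ĝ-polynomial u t ω ω w x :+ con 2 :* t :* x :* Φ₃-polynomial ω
         := con 3 :* t :* x :+ (con 2 :* t :* x :* ω :+ u :* t :* w :* (ω :+ con 1)) :* Φ₃-polynomial ω)
       refl u t ω w x))
    (3t*v≡v x)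
    where
    open Solver

  ĝ-1 : ∀ w x → ĝ 1# w x ≡ u * (1# * (1# * w))
  ĝ-1 w x = trans (≡-mod-Φ₃ 0# (t * x + u * t * w)
      (solve 5 (λ u t ω w x →
         ĝ-polynomial u t ω (con 1) w x :+ con 0 :* Φ₃-polynomial ω
         := con 3 :* t :* (u :* (con 1 :* (con 1 :* w))) :+ (t :* x :+ u :* t :* w) :* Φ₃-polynomial ω)
       refl u t ω w x))
    (3t*v≡v _)
    where
    open Solver

  ĝ-ω² : ∀ w x → ĝ (ω * ω) w x ≡ u * (ω * ω * (ω * ω * w))
  ĝ-ω² w x = trans (≡-mod-Φ₃ (t * x * ω) (u * t * w + t * x * (1# + ω * ω * ω))
      (solve 5 (λ u t ω w x →
         ĝ-polynomial u t ω (ω :* ω) w x :+ t :* x :* ω :* Φ₃-polynomial ω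
         := con 3 :* t :* (u :* (ω :* ω :* (ω :* ω :* w)))
            :+ (u :* t :* w :+ t :* x :* (con 1 :+ ω :* ω :* ω)) :* Φ₃-polynomial ω)
       refl u t ω w x))
    (3t*v≡v _)
    where
    open Solver

  -- The hypothesis 2 ≤ m is needed only here: for m = 1 the monomial x ^ (m ∸ 1) is the constant 1.
  g0≡0 : g 0# ≡ 0#
  g0≡0 = trans (g≡ĝ 0#) (trans (cong₂ (λ y w → ĝ y w 0#) (0^n≡0 m) (0^n≡0 (m ∸ 1)))
    (solve 3 (λ u t ω → ĝ-polynomial u t ω (con 0) (con 0) (con 0) := con 0) refl u t ω))
    where
    open Solver

  g-fixes-ω-class : ∀ {x} → x ^ m ≡ ω → g x ≡ x
  g-fixes-ω-class {x} xᵐ≡ω = trans (g≡ĝ x) (trans (cong (λ y → ĝ y (x ^ (m ∸ 1)) x) xᵐ≡ω) (ĝ-ω _ x))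

  Swapped : Carrier → Set
  Swapped x = x ^ m ≡ 1# ⊎ x ^ m ≡ ω * ω

  g-inverts-swapped : ∀ {x} → Swapped x → g x ≡ u * x ⁻¹
  g-inverts-swapped {x} s = trans (g≡ĝ x) (trans (ĝ-swapped s) (cong (u *_) (sym (x^[3m∸1] x))))
    where
    ĝ-swapped : ∀ {y} → y ≡ 1# ⊎ y ≡ ω * ω → ĝ y (x ^ (m ∸ 1)) x ≡ u * (y * (y * x ^ (m ∸ 1)))
    ĝ-swapped (inj₁ refl) = ĝ-1 _ x
    ĝ-swapped (inj₂ refl) = ĝ-ω² _ x

  u≢0 : u ≢ 0#
  u≢0 = x^n≢0 (3 ℕ.* k ℕ.+ 2) γ≢0

  u^m≡ω*ω : u ^ m ≡ ω * ω
  u^m≡ω*ω = begin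
    (γ ^ (3 ℕ.* k ℕ.+ 2)) ^ m            ≡⟨ ^-assocʳ γ (3 ℕ.* k ℕ.+ 2) m ⟩
    γ ^ ((3 ℕ.* k ℕ.+ 2) ℕ.* m)          ≡⟨ cong (γ ^_) ([3k+2]*m≡2*m+k*[3*m] k m) ⟩
    γ ^ (2 ℕ.* m ℕ.+ k ℕ.* (3 ℕ.* m))    ≡⟨ ^-periodic γ^N≡1 (2 ℕ.* m) k ⟩
    γ ^ (2 ℕ.* m)                        ≡⟨ γ^[2m] ⟩
    ω * ω                                ∎
    where
    open ≡-Reasoning

  swapped-u*x⁻¹ : ∀ {x} → x ≢ 0# → Swapped x → Swapped (u * x ⁻¹)
  swapped-u*x⁻¹ {x} x≢0 = λ where
      (inj₁ xᵐ≡1)   → inj₂ (trans [u*x⁻¹]ᵐ (trans (cong (ω * ω *_) (x⁻¹ᵐ≡1 xᵐ≡1)) (*-identityʳ (ω * ω))))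
      (inj₂ xᵐ≡ω*ω) → inj₁ (trans [u*x⁻¹]ᵐ (trans (cong (_* x ⁻¹ ^ m) (sym xᵐ≡ω*ω)) xᵐ*x⁻¹ᵐ≡1))
    where
    [u*x⁻¹]ᵐ : (u * x ⁻¹) ^ m ≡ ω * ω * x ⁻¹ ^ m
    [u*x⁻¹]ᵐ = trans (^-distrib-* u (x ⁻¹) m) (cong (_* x ⁻¹ ^ m) u^m≡ω*ω)

    xᵐ*x⁻¹ᵐ≡1 : x ^ m * x ⁻¹ ^ m ≡ 1#
    xᵐ*x⁻¹ᵐ≡1 = trans (sym (^-distrib-* x (x ⁻¹) m)) (trans (cong (_^ m) (x*x⁻¹≡1 x≢0)) (1^n≡1 m))

    x⁻¹ᵐ≡1 : x ^ m ≡ 1# → x ⁻¹ ^ m ≡ 1#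
    x⁻¹ᵐ≡1 xᵐ≡1 = trans (sym (*-identityˡ _)) (trans (cong (_* x ⁻¹ ^ m) (sym xᵐ≡1)) xᵐ*x⁻¹ᵐ≡1)

  g-involutive : ∀ x → g (g x) ≡ x
  g-involutive x with x ≟ 0#
  ... | yes refl = trans (cong g g0≡0) g0≡0
  ... | no x≢0 with classify x≢0
  ...   | inj₁ xᵐ≡ω = trans (cong g (g-fixes-ω-class xᵐ≡ω)) (g-fixes-ω-class xᵐ≡ω)
  ...   | inj₂ swapped = begin
    g (g x)            ≡⟨ cong g (g-inverts-swapped swapped) ⟩
    g (u * x ⁻¹)       ≡⟨ g-inverts-swapped (swapped-u*x⁻¹ x≢0 swapped) ⟩
    u * (u * x ⁻¹) ⁻¹  ≡⟨ x*y≡z⇒z*x⁻¹≡y (x*y≢0 u≢0 (x⁻¹≢0 x≢0)) u*x⁻¹*x≡u ⟩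
    x                  ∎
    where
    open ≡-Reasoning
    u*x⁻¹*x≡u : u * x ⁻¹ * x ≡ u
    u*x⁻¹*x≡u = trans (*-assoc u (x ⁻¹) x)
                  (trans (cong (u *_) (trans (*-comm (x ⁻¹) x) (x*x⁻¹≡1 x≢0))) (*-identityʳ u))

  swapped⇒not-fixed : ∀ {x} → x ≢ 0# → Swapped x → g x ≢ x
  swapped⇒not-fixed {x} x≢0 swapped gx≡x = squareᵐ≢ω*ω swapped xᵐ*xᵐ≡ω*ω
    where
    open ≡-Reasoning

    x*x≡u : x * x ≡ u
    x*x≡u = begin
      x * x              ≡⟨ cong (x *_) (trans (sym gx≡x) (g-inverts-swapped swapped)) ⟩
      x * (u * x ⁻¹)     ≡⟨ trans (*-comm x _) (*-assoc u (x ⁻¹) x) ⟩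
      u * (x ⁻¹ * x)     ≡⟨ cong (u *_) (trans (*-comm (x ⁻¹) x) (x*x⁻¹≡1 x≢0)) ⟩
      u * 1#             ≡⟨ *-identityʳ u ⟩
      u                  ∎

    xᵐ*xᵐ≡ω*ω : x ^ m * x ^ m ≡ ω * ω
    xᵐ*xᵐ≡ω*ω = trans (sym (^-distrib-* x x m)) (trans (cong (_^ m) x*x≡u) u^m≡ω*ω)

    squareᵐ≢ω*ω : Swapped x → x ^ m * x ^ m ≢ ω * ω
    squareᵐ≢ω*ω (inj₁ xᵐ≡1) e = ω*ω≢1 (begin
      ω * ω              ≡⟨ sym e ⟩
      x ^ m * x ^ m      ≡⟨ cong₂ _*_ xᵐ≡1 xᵐ≡1 ⟩
      1# * 1#            ≡⟨ *-identityʳ 1# ⟩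
      1#                 ∎)
    squareᵐ≢ω*ω (inj₂ xᵐ≡ω*ω) e = ω*ω≢1 (*-cancelˡ (x*y≢0 ω≢0 ω≢0) (begin
      ω * ω * (ω * ω)    ≡⟨ cong₂ _*_ (sym xᵐ≡ω*ω) (sym xᵐ≡ω*ω) ⟩
      x ^ m * x ^ m      ≡⟨ e ⟩
      ω * ω              ≡⟨ sym (*-identityʳ (ω * ω)) ⟩
      ω * ω * 1#         ∎))

  fixed⇒ω-class : ∀ {x} → x ≢ 0# → g x ≡ x → x ^ m ≡ ω
  fixed⇒ω-class x≢0 gx≡x with classify x≢0
  ... | inj₁ xᵐ≡ω   = xᵐ≡ω
  ... | inj₂ swapped = contradiction gx≡x (swapped⇒not-fixed x≢0 swapped)

  fixedPoint : Fin (suc m) → Carrier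
  fixedPoint Fin.zero    = 0#
  fixedPoint (Fin.suc s) = γ ^ (1 ℕ.+ toℕ s ℕ.* 3)

  fixedPoint-fixed : ∀ i → g (fixedPoint i) ≡ fixedPoint i
  fixedPoint-fixed Fin.zero    = g0≡0
  fixedPoint-fixed (Fin.suc s) = g-fixes-ω-class (begin
    (γ ^ (1 ℕ.+ toℕ s ℕ.* 3)) ^ m    ≡⟨ ^m-of-γ^ (1 ℕ.+ toℕ s ℕ.* 3) ⟩
    ω ^ ((1 ℕ.+ toℕ s ℕ.* 3) % 3)    ≡⟨ cong (ω ^_) ([m+kn]%n≡m%n 1 (toℕ s) 3) ⟩
    ω * 1#                           ≡⟨ *-identityʳ ω ⟩
    ω                                ∎)
    where
    open ≡-Reasoning

  fixedPoint-injective : ∀ {i j} → fixedPoint i ≡ fixedPoint j → i ≡ j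
  fixedPoint-injective {Fin.zero}  {Fin.zero}   _ = refl
  fixedPoint-injective {Fin.zero}  {Fin.suc s}  e = contradiction (sym e) (x^n≢0 (1 ℕ.+ toℕ s ℕ.* 3) γ≢0)
  fixedPoint-injective {Fin.suc s} {Fin.zero}   e = contradiction e (x^n≢0 (1 ℕ.+ toℕ s ℕ.* 3) γ≢0)
  fixedPoint-injective {Fin.suc s} {Fin.suc s′} e = cong Fin.suc (FinP.toℕ-injective
    (ℕP.*-cancelʳ-≡ (toℕ s) (toℕ s′) 3 (ℕP.suc-injective
      (γ^-injective (s<m⇒1+s*3<3*m (FinP.toℕ<n s)) (s<m⇒1+s*3<3*m (FinP.toℕ<n s′)) e))))

  fixedPoint-onto : ∀ x → g x ≡ x → ∃ λ i → fixedPoint i ≡ x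
  fixedPoint-onto x gx≡x with x ≟ 0#
  ... | yes refl = Fin.zero , refl
  ... | no x≢0 with i , i<3m , refl ← log x x≢0 = Fin.suc (fromℕ< i/3<m) , (begin
    γ ^ (1 ℕ.+ toℕ (fromℕ< i/3<m) ℕ.* 3)   ≡⟨ cong (λ s → γ ^ (1 ℕ.+ s ℕ.* 3)) (FinP.toℕ-fromℕ< i/3<m) ⟩
    γ ^ (1 ℕ.+ i / 3 ℕ.* 3)                ≡⟨ cong (γ ^_) (sym i≡1+[i/3]*3) ⟩
    γ ^ i                                  ∎)
    where
    open ≡-Reasoning

    i%3≡1 : i % 3 ≡ 1
    i%3≡1 = ω^-injective (m%n<n i 3) (s≤s (s≤s z≤n))
      (trans (sym (^m-of-γ^ i)) (trans (fixed⇒ω-class x≢0 gx≡x) (sym (*-identityʳ ω))))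

    i≡1+[i/3]*3 : i ≡ 1 ℕ.+ i / 3 ℕ.* 3
    i≡1+[i/3]*3 = trans (m≡m%n+[m/n]*n i 3) (cong (ℕ._+ i / 3 ℕ.* 3) i%3≡1)

    i/3<m : i / 3 < m
    i/3<m = 1+s*3<3*m⇒s<m (subst (_< 3 ℕ.* m) i≡1+[i/3]*3 i<3m)

  fixedPoints↔Fin : Σ Carrier (λ x → g x ≡ x) ↔ Fin (m ℕ.+ 1)
  fixedPoints↔Fin = subst (λ n → Σ Carrier (λ x → g x ≡ x) ↔ Fin n) (ℕP.+-comm 1 m)
    (enumeration⇒Σ↔Fin fixedPoint fixedPoint-fixed fixedPoint-injective fixedPoint-onto
      (Decidable⇒UIP.≡-irrelevant _≟_))

theorem2p5 : (q : ℕ) → IsPrimePower q → q % 2 ≡ 1 → q % 3 ≡ 1 →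
    (F : FiniteField q) → let open FiniteField F in
    (m : ℕ) → m ≡ (q ∸ 1) / 3 →
    (γ : Carrier) → IsGenerator γ →
    (k : ℕ) → k < m →
    (t : Carrier) → three * t ≡ 1# →
    let a = two * γ ^ (3 ℕ.* k ℕ.+ 2) * t
        b = γ ^ m * t
        c = - (γ ^ (m ℕ.+ 3 ℕ.* k ℕ.+ 2)) * t
        d = γ ^ (2 ℕ.* m) * t
        e = - (γ ^ (2 ℕ.* m ℕ.+ 3 ℕ.* k ℕ.+ 2)) * t
        f = t
        g = λ x → a * x ^ (3 ℕ.* m ∸ 1) + b * x ^ (2 ℕ.* m ℕ.+ 1) + c * x ^ (2 ℕ.* m ∸ 1)
                  + d * x ^ (m ℕ.+ 1) + e * x ^ (m ∸ 1) + f * x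
    in Bijective _≡_ _≡_ g × Involutory g × HasFixedPoints g (m ℕ.+ 1)
theorem2p5 q _ q%2≡1 q%3≡1 F m m≡[q∸1]/3 γ generator k k<m t 3t≡1 =
  involutive⇒bijective g g-involutive , g-involutive , fixedPoints↔Fin
  where
  q≡1+3m : q ≡ suc (3 ℕ.* m)
  q≡1+3m = subst (λ n → q ≡ suc (3 ℕ.* n)) (sym m≡[q∸1]/3) (n%3≡1⇒n≡1+3*[[n∸1]/3] q q%3≡1)

  2≤m : 2 ≤ m
  2≤m = 1+3*m-odd⇒2≤m (ℕP.≤-trans (s≤s z≤n) k<m) (subst (λ n → n % 2 ≡ 1) q≡1+3m q%2≡1)

  open Involution F q≡1+3m 2≤m generator k 3t≡1
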